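{- Let $\Gamma=(V,E,o,t)$ be a connected finite graph with finite modulus $\rho\colon I\to V$. Then the Abel--Jacobi map $\widetilde{\mathrm{AJ}}_{\mathfrak m}\colon\mathrm{Div}^0_{\mathfrak m}(\Gamma)\to\mathrm{J}_{\mathfrak m}(\Gamma)$ is surjective with kernel $\mathrm{Prin}_{\mathfrak m}(\Gamma)$, so it induces an isomorphism $\mathrm{AJ}_{\mathfrak m}\colon\mathrm{Cl}^0_{\mathfrak m}(\Gamma)\xrightarrow{\sim}\mathrm{J}_{\mathfrak m}(\Gamma)$.
   Context: Graph: $V\ne\emptyset$, $E$, $o,t\colon E\to V$ (loops, multiple edges allowed); finite, connected. Modulus: nonempty finite family $(w_i)_{i\in I}$ of vertices, $\rho(i)=w_i$, $I(v)=\rho^{ -1}(v)$. $\partial=t-o\colon\mathbb{Z}[E]\to\mathbb{Z}[V]$, $H_1(\Gamma)=\ker\partial$; $\partial^*v=\sum_{t(e)=v}e-\sum_{o(e)=v}e$, $\Delta_0=\partial\partial^*$; $d^*\colon\mathbb{Z}^E\to\mathbb{Z}^V$, $(d^*\omega)(v)=\sum_{t(e)=v}\omega(e)-\sum_{o(e)=v}\omega(e)$. $\mathrm{Div}^0_{\mathfrak m}(\Gamma)=\mathbb{Z}[V]_0\oplus\mathbb{Z}[I]$; $\mathrm{Prin}_{\mathfrak m}(\Gamma)$ is the image of $\mathbb{Z}[V]\to\mathbb{Z}[V]\oplus\mathbb{Z}[I]$, $v\mapsto(\Delta_0v,\sum_{i\in I(v)}i)$; $\mathrm{Cl}^0_{\mathfrak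 m}=\mathrm{Div}^0_{\mathfrak m}/\mathrm{Prin}_{\mathfrak m}$. Extended graph $\Gamma_{\mathfrak m}$: add a vertex $\star$ and edges $e_i$ with $o(e_i)=\star$, $t(e_i)=w_i$; $C^1(\Gamma_{\mathfrak m})=\mathbb{Z}^E\oplus\mathbb{Z}^I$, $\mathcal{H}^1(\Gamma_{\mathfrak m})=\ker d^*_{\mathfrak m}$, $d^*_{\mathfrak m}(f,g)=(d^*f+r^*g,-\sum_ig(i))$, $(r^*g)(v)=\sum_{i\in I(v)}g(i)$. $M^\vee=\mathrm{Hom}(M,\mathbb{Z})$. $\alpha_{\mathfrak m}\colon H_1(\Gamma)\to\mathcal{H}^1(\Gamma_{\mathfrak m})^\vee$, $\gamma\mapsto((f,g)\mapsto f(\gamma))$; $\mathrm{J}_{\mathfrak m}(\Gamma)=\mathcal{H}^1(\Gamma_{\mathfrak m})^\vee/\alpha_{\mathfrak m}(H_1(\Gamma))$. $\widetilde{\mathrm{AJ}}_{\mathfrak m}$ is the homomorphism sending $(D,0)$, where $D=\partial\gamma_D$ with $\gamma_D\in\mathbb{Z}[E]$, to the class of $(f,g)\mapsto f(\gamma_D)$, and $(0,i)$ to the class of $(f,g)\mapsto g(i)$ (well defined modulo $\alpha_{\mathfrak m}(H_1(\Gamma))$). -}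

module Defs where

open import Data.Nat using (ℕ; zero; suc)
open import Data.Fin using (Fin; zero; suc; _≟_)
open import Data.Integer using (ℤ; 0ℤ; 1ℤ; _+_; _-_; _*_; -_)
open import Data.Product using (Σ; ∃; _×_; _,_)
open import Function.Bundles using (_⇔_)
open import Relation.Nullary using (does)
open import Data.Bool using (if_then_else_)
open import Relation.Binary.PropositionalEquality using (_≡_)

sumFin : (n : ℕ) → (Fin n → ℤ) → ℤ
sumFin zero    a = 0ℤ
sumFin (suc n) a = a zero + sumFin n (λ i → a (suc i))

[_≟_]_ : {n : ℕ} → Fin n → Fin n → ℤ → ℤ
[ a ≟ b ] x = if does (a Data.Fin.≟ b) then x else 0ℤ

record Graph : Set where
  field
    nV nE : ℕ
    o t   : Fin nE → Fin nV

module _ (Γ : Graph) where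
  open Graph Γ

  V E : Set
  V = Fin nV
  E = Fin nE

  data Reach : V → V → Set where
    here : ∀ {v} → Reach v v
    fwd  : ∀ {w} (e : E) → Reach (t e) w → Reach (o e) w
    bwd  : ∀ {w} (e : E) → Reach (o e) w → Reach (t e) w

  Connected : Set
  Connected = ∀ v w → Reach v w

  -- ∂ = t - o : ℤ[E] → ℤ[V]   (chains as coefficient functions)
  ∂ : (E → ℤ) → (V → ℤ)
  ∂ γ v = sumFin nE (λ e → [ t e ≟ v ] γ e) - sumFin nE (λ e → [ o e ≟ v ] γ e)

  -- ∂* : ℤ[V] → ℤ[E],  ∂* v = Σ_{t e = v} e - Σ_{o e = v} e, extended linearly
  ∂* : (V → ℤ) → (E → ℤ)
  ∂* x e = sumFin nV (λ v → x v * ([ t e ≟ v ] 1ℤ - [ o e ≟ v ] 1ℤ))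

  Δ₀ : (V → ℤ) → (V → ℤ)
  Δ₀ x = ∂ (∂* x)

  d* : (E → ℤ) → (V → ℤ)
  d* ω v = sumFin nE (λ e → [ t e ≟ v ] ω e) - sumFin nE (λ e → [ o e ≟ v ] ω e)

  InH₁ : (E → ℤ) → Set
  InH₁ γ = ∀ v → ∂ γ v ≡ 0ℤ

  deg : (V → ℤ) → ℤ
  deg D = sumFin nV D

  ⟪_,_⟫ : (E → ℤ) → (E → ℤ) → ℤ
  ⟪ f , γ ⟫ = sumFin nE (λ e → f e * γ e)

  module _ (nI : ℕ) (ρ : Fin nI → V) where
    I : Set
    I = Fin nI

    r* : (I → ℤ) → (V → ℤ)
    r* g v = sumFin nI (λ i → [ ρ i ≟ v ] g i)

    -- (f , g) ∈ 𝓗¹(Γ_𝔪) = ker d*_𝔪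
    IsCocycle : (E → ℤ) → (I → ℤ) → Set
    IsCocycle f g = (∀ v → d* f v + r* g v ≡ 0ℤ) × (- sumFin nI g ≡ 0ℤ)

    Functional : Set
    Functional = (f : E → ℤ) (g : I → ℤ) → IsCocycle f g → ℤ

    record Dual : Set where
      field
        fun      : Functional
        -- depends only on the element (f , g), not on its representation
        ext      : ∀ f g f' g' (p : IsCocycle f g) (p' : IsCocycle f' g') →
                   (∀ e → f e ≡ f' e) → (∀ i → g i ≡ g' i) → fun f g p ≡ fun f' g' p'
        additive : ∀ f g f' g' (p : IsCocycle f g) (p' : IsCocycle f' g')
                   (q : IsCocycle (λ e → f e + f' e) (λ i → g i + g' i)) →
                   fun (λ e → f e + f' e) (λ i → g i + g' i) q ≡ fun f g p + fun f' g' p'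

    -- equality in J_𝔪(Γ) = 𝓗¹(Γ_𝔪)^∨ / α_𝔪(H₁(Γ)):  φ - ψ = α_𝔪(δ) for some δ ∈ H₁(Γ)
    _~J_ : Functional → Functional → Set
    φ ~J ψ = ∃ λ δ → InH₁ δ × (∀ f g (p : IsCocycle f g) → φ f g p ≡ ψ f g p + ⟪ f , δ ⟫)

    zeroJ : Functional
    zeroJ f g p = 0ℤ

    -- the functional representing AJ̃_𝔪(∂γ , c) = AJ̃_𝔪(∂γ,0) + Σ_i c(i) AJ̃_𝔪(0,i):
    -- (f , g) ↦ f(γ) + Σ_i c(i) g(i)
    ajFun : (E → ℤ) → (I → ℤ) → Functional
    ajFun γ c f g p = ⟪ f , γ ⟫ + sumFin nI (λ i → c i * g i)

    -- (D , c) ∈ Prin_𝔪(Γ): image of x = Σ_v x(v) v under v ↦ (Δ₀ v , Σ_{i∈I(v)} i)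
    InPrin : (V → ℤ) → (I → ℤ) → Set
    InPrin D c = ∃ λ (x : V → ℤ) →
                   (∀ v → D v ≡ Δ₀ x v) ×
                   (∀ i → c i ≡ sumFin nV (λ v → x v * [ ρ i ≟ v ] 1ℤ))

-- Fix w₀ = ρ 0 and, by connectedness, a walk π_v from w₀ to every vertex v, read as a
-- 1-chain with ∂ π_v = v - w₀; then Σ_v D(v) π_v is a preimage under ∂ of any degree-zero D.
-- Since d*_𝔪 is the boundary map of the extended graph Γ_𝔪, 𝓗¹(Γ_𝔪) is its cycle space.
-- It is spanned by the fundamental cycles Z_e = e + π_{o e} - π_{t e} (one per edge) and
-- Y_i = e_i - e_0 - π_{w_i} (one per leg): every cocycle (f, g) equals Σ_e f(e) Z_e + Σ_i g(i) Y_i,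
-- because cocycles are orthogonal to coboundaries.  So a functional φ on 𝓗¹(Γ_𝔪) is the
-- Abel–Jacobi image of (γ, c) with γ(e) = φ(Z_e) and c(i) = φ(Y_i).  Conversely, if (y, c)
-- pairs to zero with every cocycle, pairing with Z_e and Y_i shows y = ∂* x and c = x ∘ ρ for the
-- potential x(v) = c(0) + ⟨y, π_v⟩, so (∂ y, c) is principal; orthogonality gives the converse.

module Submission where

open import Defs
open import Data.Nat using (ℕ; zero; suc)
open import Data.Fin using (Fin; zero; suc)
open import Data.Integer using (ℤ; 0ℤ; 1ℤ; -1ℤ; +_; -[1+_]; _+_; _-_; _*_; -_)
open import Data.Integer.Properties hiding (_≟_)
open import Data.Integer.Tactic.RingSolver using (solve-∀)
open import Data.Product using (∃; _×_; _,_; proj₁; proj₂)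
open import Function.Bundles using (_⇔_; mk⇔)
open import Function.Base using (_∘_)
open import Relation.Binary.PropositionalEquality
  using (_≡_; _≗_; refl; sym; trans; cong; cong₂; module ≡-Reasoning)
import Algebra.Properties.Semiring.Sum +-*-semiring as Sum
open import Algebra.Properties.AbelianGroup +-0-abelianGroup
  using (identityʳ-unique; inverseʳ-unique; x∙y⁻¹≈ε⇒x≈y; x≈y⇒x∙y⁻¹≈ε)

sumFin≡sum : ∀ n (a : Fin n → ℤ) → sumFin n a ≡ Sum.sum a
sumFin≡sum zero    a = refl
sumFin≡sum (suc n) a = cong (_+_ (a zero)) (sumFin≡sum n (a ∘ suc))

sumFin-cong : ∀ {n} {a b : Fin n → ℤ} → a ≗ b → sumFin n a ≡ sumFin n b
sumFin-cong {n} {a} {b} a≗b =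
  trans (sumFin≡sum n a) (trans (Sum.sum-cong-≗ a≗b) (sym (sumFin≡sum n b)))

sumFin-zero : ∀ n → sumFin n (λ _ → 0ℤ) ≡ 0ℤ
sumFin-zero n = trans (sumFin≡sum n _) (Sum.sum-replicate-zero n)

sumFin-distrib-+ : ∀ n (a b : Fin n → ℤ) →
                   sumFin n (λ k → a k + b k) ≡ sumFin n a + sumFin n b
sumFin-distrib-+ n a b = begin
  sumFin _ (λ k → a k + b k)  ≡⟨ sumFin≡sum n _ ⟩
  Sum.sum (λ k → a k + b k)   ≡⟨ Sum.∑-distrib-+ a b ⟩
  Sum.sum a + Sum.sum b       ≡⟨ sym (cong₂ _+_ (sumFin≡sum n a) (sumFin≡sum n b)) ⟩
  sumFin _ a + sumFin _ b     ∎
  where open ≡-Reasoning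

*-distribˡ-sumFin : ∀ n x (a : Fin n → ℤ) → x * sumFin n a ≡ sumFin n (λ k → x * a k)
*-distribˡ-sumFin n x a = begin
  x * sumFin _ a              ≡⟨ cong (x *_) (sumFin≡sum n a) ⟩
  x * Sum.sum a               ≡⟨ Sum.*-distribˡ-sum x a ⟩
  Sum.sum (λ k → x * a k)     ≡⟨ sym (sumFin≡sum n _) ⟩
  sumFin _ (λ k → x * a k)    ∎
  where open ≡-Reasoning

neg-distrib-sumFin : ∀ n (a : Fin n → ℤ) → - sumFin n a ≡ sumFin n (λ k → - a k)
neg-distrib-sumFin n a = begin
  - sumFin _ a               ≡⟨ sym (-1*i≡-i _) ⟩
  -1ℤ * sumFin _ a           ≡⟨ *-distribˡ-sumFin n -1ℤ a ⟩
  sumFin _ (λ k → -1ℤ * a k) ≡⟨ sumFin-cong (λ k → -1*i≡-i (a k)) ⟩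
  sumFin _ (λ k → - a k)     ∎
  where open ≡-Reasoning

sumFin-distrib-- : ∀ n (a b : Fin n → ℤ) → sumFin n (λ k → a k - b k) ≡ sumFin n a - sumFin n b
sumFin-distrib-- n a b =
  trans (sumFin-distrib-+ n a (λ k → - b k)) (cong (_+_ (sumFin n a)) (sym (neg-distrib-sumFin n b)))

sumFin-comm : ∀ m n (M : Fin m → Fin n → ℤ) →
              sumFin m (λ i → sumFin n (M i)) ≡ sumFin n (λ j → sumFin m (λ i → M i j))
sumFin-comm m n M = begin
  sumFin _ (λ i → sumFin _ (M i))          ≡⟨ sumFin-cong (λ i → sumFin≡sum n (M i)) ⟩
  sumFin _ (λ i → Sum.sum (M i))           ≡⟨ sumFin≡sum m _ ⟩
  Sum.sum (λ i → Sum.sum (M i))            ≡⟨ Sum.∑-comm M ⟩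
  Sum.sum (λ j → Sum.sum (λ i → M i j))    ≡⟨ sym (sumFin≡sum n _) ⟩
  sumFin _ (λ j → Sum.sum (λ i → M i j))   ≡⟨ sym (sumFin-cong (λ j → sumFin≡sum m (λ i → M i j))) ⟩
  sumFin _ (λ j → sumFin _ (λ i → M i j))  ∎
  where open ≡-Reasoning

additive⇒linear : (h : ℤ → ℤ) → (∀ a b → h (a + b) ≡ h a + h b) → ∀ a → h a ≡ a * h 1ℤ
additive⇒linear h h-+ = linear
  where
    open ≡-Reasoning

    linear-ℕ : ∀ n → h (+ n) ≡ + n * h 1ℤ
    linear-ℕ zero    = identityʳ-unique (h 0ℤ) (h 0ℤ) (sym (h-+ 0ℤ 0ℤ))
    linear-ℕ (suc n) = begin
      h (1ℤ + + n)              ≡⟨ h-+ 1ℤ (+ n) ⟩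
      h 1ℤ + h (+ n)            ≡⟨ cong₂ _+_ (sym (*-identityˡ (h 1ℤ))) (linear-ℕ n) ⟩
      1ℤ * h 1ℤ + + n * h 1ℤ    ≡⟨ sym (*-distribʳ-+ (h 1ℤ) 1ℤ (+ n)) ⟩
      (1ℤ + + n) * h 1ℤ         ∎

    linear : ∀ a → h a ≡ a * h 1ℤ
    linear (+ n)    = linear-ℕ n
    linear -[1+ n ] = begin
      h -[1+ n ]                ≡⟨ inverseʳ-unique (h (+ suc n)) (h -[1+ n ]) h[n]+h[-n]≡0 ⟩
      - h (+ suc n)             ≡⟨ cong -_ (linear-ℕ (suc n)) ⟩
      - (+ suc n * h 1ℤ)        ≡⟨ neg-distribˡ-* (+ suc n) (h 1ℤ) ⟩
      -[1+ n ] * h 1ℤ           ∎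
      where
        h[n]+h[-n]≡0 : h (+ suc n) + h -[1+ n ] ≡ 0ℤ
        h[n]+h[-n]≡0 = trans (sym (h-+ (+ suc n) -[1+ n ]))
                             (trans (cong h (+-inverseʳ (+ suc n))) (linear-ℕ 0))

infix 7 _·_

_·_ : ∀ {n} → (Fin n → ℤ) → (Fin n → ℤ) → ℤ
_·_ {n} a b = sumFin n (λ k → a k * b k)

·-comm : ∀ {n} (a b : Fin n → ℤ) → a · b ≡ b · a
·-comm a b = sumFin-cong (λ k → *-comm (a k) (b k))

·-congʳ : ∀ {n} (a : Fin n → ℤ) {b c : Fin n → ℤ} → b ≗ c → a · b ≡ a · c
·-congʳ a b≗c = sumFin-cong (λ k → cong (a k *_) (b≗c k))

·-zeroʳ : ∀ {n} (a : Fin n → ℤ) → a · (λ _ → 0ℤ) ≡ 0ℤ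
·-zeroʳ {n} a = trans (sumFin-cong (λ k → *-zeroʳ (a k))) (sumFin-zero n)

·-distribˡ-+ : ∀ {n} (a b c : Fin n → ℤ) → a · (λ k → b k + c k) ≡ a · b + a · c
·-distribˡ-+ {n} a b c =
  trans (sumFin-cong (λ k → *-distribˡ-+ (a k) (b k) (c k))) (sumFin-distrib-+ n _ _)

·-scaleʳ : ∀ {n} (a b : Fin n → ℤ) x → a · (λ k → x * b k) ≡ x * (a · b)
·-scaleʳ {n} a b x = trans (sumFin-cong (λ k → swap (a k) x (b k))) (sym (*-distribˡ-sumFin n x _))
  where swap : ∀ y x z → y * (x * z) ≡ x * (y * z)
        swap = solve-∀

·-negʳ : ∀ {n} (a b : Fin n → ℤ) → a · (λ k → - b k) ≡ - (a · b)
·-negʳ {n} a b =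
  trans (sumFin-cong (λ k → sym (neg-distribʳ-* (a k) (b k)))) (sym (neg-distrib-sumFin n _))

·-distribˡ-- : ∀ {n} (a b c : Fin n → ℤ) → a · (λ k → b k - c k) ≡ a · b - a · c
·-distribˡ-- a b c = trans (·-distribˡ-+ a b (λ k → - c k)) (cong (_+_ (a · b)) (·-negʳ a c))

·-constʳ : ∀ {n} (a : Fin n → ℤ) x → a · (λ _ → x) ≡ x * sumFin n a
·-constʳ {n} a x = trans (sumFin-cong (λ k → *-comm (a k) x)) (sym (*-distribˡ-sumFin n x a))

·-transpose : ∀ {m n} (a : Fin n → ℤ) (b : Fin m → ℤ) (M : Fin m → Fin n → ℤ) →
              a · (λ j → b · (λ i → M i j)) ≡ b · (λ i → M i · a)
·-transpose {m} {n} a b M = begin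
  a · (λ j → b · (λ i → M i j))
    ≡⟨ sumFin-cong (λ j → *-distribˡ-sumFin m (a j) _) ⟩
  sumFin n (λ j → sumFin m (λ i → a j * (b i * M i j)))
    ≡⟨ sumFin-comm n m _ ⟩
  sumFin m (λ i → sumFin n (λ j → a j * (b i * M i j)))
    ≡⟨ sumFin-cong (λ i → sumFin-cong (λ j → shuffle (a j) (b i) (M i j))) ⟩
  sumFin m (λ i → sumFin n (λ j → b i * (M i j * a j)))
    ≡⟨ sym (sumFin-cong (λ i → *-distribˡ-sumFin n (b i) _)) ⟩
  b · (λ i → M i · a)
    ∎
  where open ≡-Reasoning
        shuffle : ∀ x y z → x * (y * z) ≡ y * (z * x)
        shuffle = solve-∀

δ : ∀ {n} → Fin n → Fin n → ℤ
δ a b = [ a ≟ b ] 1ℤ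

[≟]≡δ* : ∀ {n} (a b : Fin n) x → [ a ≟ b ] x ≡ δ a b * x
[≟]≡δ* zero    zero    x = sym (*-identityˡ x)
[≟]≡δ* zero    (suc b) x = refl
[≟]≡δ* (suc a) zero    x = refl
[≟]≡δ* (suc a) (suc b) x = [≟]≡δ* a b x

δ-sym : ∀ {n} (a b : Fin n) → δ a b ≡ δ b a
δ-sym zero    zero    = refl
δ-sym zero    (suc b) = refl
δ-sym (suc a) zero    = refl
δ-sym (suc a) (suc b) = δ-sym a b

·-δ : ∀ {n} (a : Fin n → ℤ) i → a · δ i ≡ a i
·-δ a zero    = trans (cong₂ _+_ (*-identityʳ (a zero)) (·-zeroʳ (a ∘ suc))) (+-identityʳ (a zero))
·-δ a (suc i) = trans (cong₂ _+_ (*-zeroʳ (a zero)) (·-δ (a ∘ suc) i)) (+-identityˡ (a (suc i)))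

sumFin-δ : ∀ {n} (i : Fin n) → sumFin n (δ i) ≡ 1ℤ
sumFin-δ i = trans (sumFin-cong (λ k → sym (*-identityˡ (δ i k)))) (·-δ _ i)

-- ∂ Γ γ v and d* Γ γ v both unfold to push t γ v - push o γ v, and r* Γ nI ρ g v to push ρ g v.
push : ∀ {m n} → (Fin n → Fin m) → (Fin n → ℤ) → Fin m → ℤ
push {n = n} a x v = sumFin n (λ k → [ a k ≟ v ] x k)

module _ {m n} (a : Fin n → Fin m) where

  private
    fibre : Fin m → Fin n → ℤ
    fibre v k = δ (a k) v

  push≡· : ∀ x v → push a x v ≡ fibre v · x
  push≡· x v = sumFin-cong (λ k → [≟]≡δ* (a k) v (x k))

  push-δ : ∀ k v → push a (δ k) v ≡ δ (a k) v
  push-δ k v = trans (push≡· (δ k) v) (·-δ (fibre v) k)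

  ·-push : ∀ (x : Fin n → ℤ) (F : Fin m → ℤ) → x · (F ∘ a) ≡ F · push a x
  ·-push x F = begin
    x · (F ∘ a)                   ≡⟨ sym (·-congʳ x (λ k → ·-δ F (a k))) ⟩
    x · (λ k → F · δ (a k))       ≡⟨ ·-transpose x F fibre ⟩
    F · (λ v → fibre v · x)       ≡⟨ sym (·-congʳ F (push≡· x)) ⟩
    F · push a x                  ∎
    where open ≡-Reasoning

  push-cong : ∀ {x y : Fin n → ℤ} → x ≗ y → ∀ v → push a x v ≡ push a y v
  push-cong x≗y v = sumFin-cong (λ k → cong (λ z → [ a k ≟ v ] z) (x≗y k))

  push-zero : ∀ v → push a (λ _ → 0ℤ) v ≡ 0ℤ
  push-zero v = trans (push≡· _ v) (·-zeroʳ (fibre v))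

  push-+ : ∀ x y v → push a (λ k → x k + y k) v ≡ push a x v + push a y v
  push-+ x y v = trans (push≡· _ v)
    (trans (·-distribˡ-+ (fibre v) x y) (sym (cong₂ _+_ (push≡· x v) (push≡· y v))))

  push-neg : ∀ x v → push a (λ k → - x k) v ≡ - push a x v
  push-neg x v = trans (push≡· _ v) (trans (·-negʳ (fibre v) x) (sym (cong -_ (push≡· x v))))

  push-- : ∀ x y v → push a (λ k → x k - y k) v ≡ push a x v - push a y v
  push-- x y v = trans (push-+ x (λ k → - y k) v) (cong (_+_ (push a x v)) (push-neg y v))

  push-scale : ∀ s x v → push a (λ k → s * x k) v ≡ s * push a x v
  push-scale s x v = trans (push≡· _ v) (trans (·-scaleʳ (fibre v) x s) (sym (cong (s *_) (push≡· x v))))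

  push-· : ∀ {l} (b : Fin l → ℤ) (M : Fin l → Fin n → ℤ) v →
           push a (λ k → b · (λ i → M i k)) v ≡ b · (λ i → push a (M i) v)
  push-· b M v = trans (push≡· _ v) (trans (·-transpose (fibre v) b M) (sym (·-congʳ b push≡·ᵀ)))
    where push≡·ᵀ : ∀ i → push a (M i) v ≡ M i · fibre v
          push≡·ᵀ i = trans (push≡· (M i) v) (·-comm (fibre v) (M i))

module Boundary (Γ : Graph) where
  open Graph Γ

  private
    interchange : ∀ a b c d → (a + b) - (c + d) ≡ (a - c) + (b - d)
    interchange = solve-∀

  ∂-cong : ∀ {x y} → x ≗ y → ∀ v → ∂ Γ x v ≡ ∂ Γ y v
  ∂-cong x≗y v = cong₂ _-_ (push-cong t x≗y v) (push-cong o x≗y v)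

  ∂-zero : ∀ v → ∂ Γ (λ _ → 0ℤ) v ≡ 0ℤ
  ∂-zero v = cong₂ _-_ (push-zero t v) (push-zero o v)

  ∂-δ : ∀ e v → ∂ Γ (δ e) v ≡ δ (t e) v - δ (o e) v
  ∂-δ e v = cong₂ _-_ (push-δ t e v) (push-δ o e v)

  ∂-+ : ∀ x y v → ∂ Γ (λ e → x e + y e) v ≡ ∂ Γ x v + ∂ Γ y v
  ∂-+ x y v = trans (cong₂ _-_ (push-+ t x y v) (push-+ o x y v))
    (interchange (push t x v) (push t y v) (push o x v) (push o y v))

  ∂-neg : ∀ x v → ∂ Γ (λ e → - x e) v ≡ - ∂ Γ x v
  ∂-neg x v = trans (cong₂ _-_ (push-neg t x v) (push-neg o x v)) (neg-difference (push t x v) (push o x v))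
    where neg-difference : ∀ a b → - a - - b ≡ - (a - b)
          neg-difference = solve-∀

  ∂-- : ∀ x y v → ∂ Γ (λ e → x e - y e) v ≡ ∂ Γ x v - ∂ Γ y v
  ∂-- x y v = trans (∂-+ x (λ e → - y e) v) (cong (_+_ (∂ Γ x v)) (∂-neg y v))

  ∂-scale : ∀ s x v → ∂ Γ (λ e → s * x e) v ≡ s * ∂ Γ x v
  ∂-scale s x v = trans (cong₂ _-_ (push-scale t s x v) (push-scale o s x v))
                        (sym (*-distribˡ-- s (push t x v) (push o x v)))
    where *-distribˡ-- : ∀ s a b → s * (a - b) ≡ s * a - s * b
          *-distribˡ-- = solve-∀

  ∂-· : ∀ {l} (b : Fin l → ℤ) (M : Fin l → Fin nE → ℤ) v →
        ∂ Γ (λ e → b · (λ i → M i e)) v ≡ b · (λ i → ∂ Γ (M i) v)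
  ∂-· b M v = trans (cong₂ _-_ (push-· t b M v) (push-· o b M v)) (sym (·-distribˡ-- b _ _))

  ∂*≡ : ∀ x e → ∂* Γ x e ≡ x (t e) - x (o e)
  ∂*≡ x e = trans (·-distribˡ-- x (δ (t e)) (δ (o e))) (cong₂ _-_ (·-δ x (t e)) (·-δ x (o e)))

  ·-∂* : ∀ f F → f · ∂* Γ F ≡ F · ∂ Γ f
  ·-∂* f F = begin
    f · ∂* Γ F                                      ≡⟨ ·-congʳ f (∂*≡ F) ⟩
    f · (λ e → F (t e) - F (o e))                   ≡⟨ ·-distribˡ-- f _ _ ⟩
    f · (λ e → F (t e)) - f · (λ e → F (o e))       ≡⟨ cong₂ _-_ (·-push t f F) (·-push o f F) ⟩
    F · push t f - F · push o f                     ≡⟨ sym (·-distribˡ-- F _ _) ⟩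
    F · ∂ Γ f                                       ∎
    where open ≡-Reasoning

  deg-∂ : ∀ γ → deg Γ (∂ Γ γ) ≡ 0ℤ
  deg-∂ γ = begin
    sumFin nV (∂ Γ γ)              ≡⟨ sumFin-cong (λ v → sym (*-identityˡ (∂ Γ γ v))) ⟩
    (λ _ → 1ℤ) · ∂ Γ γ             ≡⟨ sym (·-∂* γ (λ _ → 1ℤ)) ⟩
    γ · ∂* Γ (λ _ → 1ℤ)            ≡⟨ ·-congʳ γ (λ e → trans (∂*≡ (λ _ → 1ℤ) e) (+-inverseʳ 1ℤ)) ⟩
    γ · (λ _ → 0ℤ)                 ≡⟨ ·-zeroʳ γ ⟩
    0ℤ                             ∎
    where open ≡-Reasoning

  pathChain : ∀ {a b} → Reach Γ a b → Fin nE → ℤ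
  pathChain here      e′ = 0ℤ
  pathChain (fwd e r) e′ = δ e e′ + pathChain r e′
  pathChain (bwd e r) e′ = - δ e e′ + pathChain r e′

  ∂-pathChain : ∀ {a b} (r : Reach Γ a b) v → ∂ Γ (pathChain r) v ≡ δ b v - δ a v
  ∂-pathChain {a} here v = trans (∂-zero v) (sym (+-inverseʳ (δ a v)))
  ∂-pathChain {b = b} (fwd e r) v =
    trans (∂-+ (δ e) (pathChain r) v)
          (trans (cong₂ _+_ (∂-δ e v) (∂-pathChain r v)) (telescope (δ (t e) v) (δ (o e) v) (δ b v)))
    where telescope : ∀ x y z → (x - y) + (z - x) ≡ z - y
          telescope = solve-∀
  ∂-pathChain {b = b} (bwd e r) v =
    trans (∂-+ (λ e′ → - δ e e′) (pathChain r) v)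
          (trans (cong₂ _+_ (trans (∂-neg (δ e) v) (cong -_ (∂-δ e v))) (∂-pathChain r v))
                 (telescope (δ (t e) v) (δ (o e) v) (δ b v)))
    where telescope : ∀ x y z → - (x - y) + (z - y) ≡ z - x
          telescope = solve-∀

  module Cocycles (nI : ℕ) (ρ : Fin nI → Fin nV) where

    cocycle-orthogonal : ∀ {f g} → IsCocycle Γ nI ρ f g →
                         ∀ F → f · ∂* Γ F + g · (λ i → F (ρ i)) ≡ 0ℤ
    cocycle-orthogonal {f} {g} (∂f+r*g≡0 , _) F = begin
      f · ∂* Γ F + g · (λ i → F (ρ i))           ≡⟨ cong₂ _+_ (·-∂* f F) (·-push ρ g F) ⟩
      F · ∂ Γ f + F · push ρ g                   ≡⟨ sym (·-distribˡ-+ F _ _) ⟩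
      F · (λ v → ∂ Γ f v + r* Γ nI ρ g v)        ≡⟨ ·-congʳ F ∂f+r*g≡0 ⟩
      F · (λ _ → 0ℤ)                             ≡⟨ ·-zeroʳ F ⟩
      0ℤ                                         ∎
      where open ≡-Reasoning

    record Cocycle : Set where
      constructor cocycle
      field
        f      : Fin nE → ℤ
        g      : Fin nI → ℤ
        closed : IsCocycle Γ nI ρ f g

    open Cocycle

    0ᶜ : Cocycle
    0ᶜ = cocycle (λ _ → 0ℤ) (λ _ → 0ℤ)
                 ((λ v → cong₂ _+_ (∂-zero v) (push-zero ρ v)) , cong -_ (sumFin-zero nI))

    infixl 6 _+ᶜ_
    infixr 7 _*ᶜ_

    _+ᶜ_ : Cocycle → Cocycle → Cocycle
    cocycle f g (∂f+r*g≡0 , -Σg≡0) +ᶜ cocycle f′ g′ (∂f′+r*g′≡0 , -Σg′≡0) =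
      cocycle (λ e → f e + f′ e) (λ i → g i + g′ i) (∂+r*≡0 , -Σ≡0)
      where
        middle-swap : ∀ a b c d → (a + b) + (c + d) ≡ (a + c) + (b + d)
        middle-swap = solve-∀
        ∂+r*≡0 : ∀ v → ∂ Γ (λ e → f e + f′ e) v + push ρ (λ i → g i + g′ i) v ≡ 0ℤ
        ∂+r*≡0 v = trans (cong₂ _+_ (∂-+ f f′ v) (push-+ ρ g g′ v))
                         (trans (middle-swap (∂ Γ f v) (∂ Γ f′ v) (push ρ g v) (push ρ g′ v))
                                (cong₂ _+_ (∂f+r*g≡0 v) (∂f′+r*g′≡0 v)))
        -Σ≡0 : - sumFin nI (λ i → g i + g′ i) ≡ 0ℤ
        -Σ≡0 = trans (cong -_ (sumFin-distrib-+ nI g g′))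
                     (trans (neg-distrib-+ (sumFin nI g) (sumFin nI g′)) (cong₂ _+_ -Σg≡0 -Σg′≡0))

    _*ᶜ_ : ℤ → Cocycle → Cocycle
    s *ᶜ cocycle f g (∂f+r*g≡0 , -Σg≡0) =
      cocycle (λ e → s * f e) (λ i → s * g i) (∂+r*≡0 , -Σ≡0)
      where
        ∂+r*≡0 : ∀ v → ∂ Γ (λ e → s * f e) v + push ρ (λ i → s * g i) v ≡ 0ℤ
        ∂+r*≡0 v = begin
          ∂ Γ (λ e → s * f e) v + push ρ (λ i → s * g i) v ≡⟨ cong₂ _+_ (∂-scale s f v) (push-scale ρ s g v) ⟩
          s * ∂ Γ f v + s * push ρ g v                     ≡⟨ sym (*-distribˡ-+ s _ _) ⟩
          s * (∂ Γ f v + push ρ g v)                       ≡⟨ cong (s *_) (∂f+r*g≡0 v) ⟩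
          s * 0ℤ                                           ≡⟨ *-zeroʳ s ⟩
          0ℤ                                               ∎
          where open ≡-Reasoning
        -Σ≡0 : - sumFin nI (λ i → s * g i) ≡ 0ℤ
        -Σ≡0 = begin
          - sumFin nI (λ i → s * g i)   ≡⟨ cong -_ (sym (*-distribˡ-sumFin nI s g)) ⟩
          - (s * sumFin nI g)           ≡⟨ neg-distribʳ-* s _ ⟩
          s * - sumFin nI g             ≡⟨ cong (s *_) -Σg≡0 ⟩
          s * 0ℤ                        ≡⟨ *-zeroʳ s ⟩
          0ℤ                            ∎
          where open ≡-Reasoning

    lincomb : ∀ {N} → (Fin N → ℤ) → (Fin N → Cocycle) → Cocycle
    lincomb {zero}  a c = 0ᶜ
    lincomb {suc N} a c = a zero *ᶜ c zero +ᶜ lincomb (a ∘ suc) (c ∘ suc)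

    f-lincomb : ∀ {N} a (c : Fin N → Cocycle) e → f (lincomb a c) e ≡ a · (λ k → f (c k) e)
    f-lincomb {zero}  a c e = refl
    f-lincomb {suc N} a c e = cong (_+_ (a zero * f (c zero) e)) (f-lincomb (a ∘ suc) (c ∘ suc) e)

    g-lincomb : ∀ {N} a (c : Fin N → Cocycle) i → g (lincomb a c) i ≡ a · (λ k → g (c k) i)
    g-lincomb {zero}  a c i = refl
    g-lincomb {suc N} a c i = cong (_+_ (a zero * g (c zero) i)) (g-lincomb (a ∘ suc) (c ∘ suc) i)

    module Evaluation (φ : Dual Γ nI ρ) where
      open Dual φ

      eval : Cocycle → ℤ
      eval c = fun (f c) (g c) (closed c)

      eval-cong : ∀ c c′ → f c ≗ f c′ → g c ≗ g c′ → eval c ≡ eval c′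
      eval-cong c c′ = ext _ _ _ _ (closed c) (closed c′)

      eval-+ : ∀ c c′ → eval (c +ᶜ c′) ≡ eval c + eval c′
      eval-+ c c′ = additive _ _ _ _ (closed c) (closed c′) (closed (c +ᶜ c′))

      eval-* : ∀ s c → eval (s *ᶜ c) ≡ s * eval c
      eval-* s c = trans (additive⇒linear (λ s → eval (s *ᶜ c)) eval-distrib s)
                         (cong (s *_) (eval-cong (1ℤ *ᶜ c) c (*-identityˡ ∘ f c) (*-identityˡ ∘ g c)))
        where
          eval-distrib : ∀ a b → eval ((a + b) *ᶜ c) ≡ eval (a *ᶜ c) + eval (b *ᶜ c)
          eval-distrib a b =
            trans (eval-cong ((a + b) *ᶜ c) (a *ᶜ c +ᶜ b *ᶜ c)
                             (λ e → *-distribʳ-+ (f c e) a b) (λ i → *-distribʳ-+ (g c i) a b))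
                  (eval-+ (a *ᶜ c) (b *ᶜ c))

      eval-lincomb : ∀ {N} a (c : Fin N → Cocycle) → eval (lincomb a c) ≡ a · (eval ∘ c)
      eval-lincomb {zero}  a c =
        trans (eval-cong 0ᶜ (0ℤ *ᶜ 0ᶜ) (λ _ → refl) (λ _ → refl)) (eval-* 0ℤ 0ᶜ)
      eval-lincomb {suc N} a c =
        trans (eval-+ (a zero *ᶜ c zero) (lincomb (a ∘ suc) (c ∘ suc)))
              (cong₂ _+_ (eval-* (a zero) (c zero)) (eval-lincomb (a ∘ suc) (c ∘ suc)))

module Paths (Γ : Graph) (connected : Connected Γ) (base : Fin (Graph.nV Γ)) where
  open Graph Γ
  open Boundary Γ

  path : Fin nV → Fin nE → ℤ
  path v = pathChain (connected base v)

  ∂-path : ∀ v u → ∂ Γ (path v) u ≡ δ v u - δ base u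
  ∂-path v = ∂-pathChain (connected base v)

  deg≡0⇒boundary : ∀ D → deg Γ D ≡ 0ℤ → ∃ λ γ → ∀ v → ∂ Γ γ v ≡ D v
  deg≡0⇒boundary D degD≡0 = (λ e → D · (λ v → path v e)) , ∂γ≡D
    where
      open ≡-Reasoning
      ∂γ≡D : ∀ u → ∂ Γ (λ e → D · (λ v → path v e)) u ≡ D u
      ∂γ≡D u = begin
        ∂ Γ (λ e → D · (λ v → path v e)) u              ≡⟨ ∂-· D path u ⟩
        D · (λ v → ∂ Γ (path v) u)                      ≡⟨ ·-congʳ D (λ v → ∂-path v u) ⟩
        D · (λ v → δ v u - δ base u)                    ≡⟨ ·-distribˡ-- D _ _ ⟩
        D · (λ v → δ v u) - D · (λ _ → δ base u)
          ≡⟨ cong₂ _-_ (·-congʳ D (λ v → δ-sym v u)) (·-constʳ D _) ⟩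
        D · δ u - δ base u * deg Γ D                    ≡⟨ cong₂ _-_ (·-δ D u) (cong (δ base u *_) degD≡0) ⟩
        D u - δ base u * 0ℤ                             ≡⟨ cong (_+_ (D u)) (cong -_ (*-zeroʳ (δ base u))) ⟩
        D u + 0ℤ                                        ≡⟨ +-identityʳ (D u) ⟩
        D u                                             ∎

module AbelJacobi (Γ : Graph) (connected : Connected Γ) {m : ℕ} (ρ : Fin (suc m) → Fin (Graph.nV Γ)) where
  open Graph Γ
  open Boundary Γ
  open Cocycles (suc m) ρ
  open Paths Γ connected (ρ zero)
  open Cocycle

  fundamentalCycle : Fin nE → Fin nE → ℤ
  fundamentalCycle e e′ = δ e e′ - (path (t e) e′ - path (o e) e′)

  edgeCycle : Fin nE → Cocycle
  edgeCycle e = cocycle (fundamentalCycle e) (λ _ → 0ℤ) (∂z≡0 , cong -_ (sumFin-zero (suc m)))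
    where
      cancel : ∀ a b c → (a - b) - ((a - c) - (b - c)) + 0ℤ ≡ 0ℤ
      cancel = solve-∀
      ∂z≡0 : ∀ v → ∂ Γ (fundamentalCycle e) v + push ρ (λ _ → 0ℤ) v ≡ 0ℤ
      ∂z≡0 v = begin
        ∂ Γ (fundamentalCycle e) v + push ρ (λ _ → 0ℤ) v
          ≡⟨ cong₂ _+_ (∂-- (δ e) (λ e′ → path (t e) e′ - path (o e) e′) v) (push-zero ρ v) ⟩
        ∂ Γ (δ e) v - ∂ Γ (λ e′ → path (t e) e′ - path (o e) e′) v + 0ℤ
          ≡⟨ cong (λ z → z + 0ℤ) (cong₂ _-_ (∂-δ e v)
               (trans (∂-- (path (t e)) (path (o e)) v) (cong₂ _-_ (∂-path (t e) v) (∂-path (o e) v)))) ⟩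
        (δ (t e) v - δ (o e) v) - ((δ (t e) v - δ (ρ zero) v) - (δ (o e) v - δ (ρ zero) v)) + 0ℤ
          ≡⟨ cancel (δ (t e) v) (δ (o e) v) (δ (ρ zero) v) ⟩
        0ℤ ∎
        where open ≡-Reasoning

  legCycle : Fin (suc m) → Cocycle
  legCycle i = cocycle (λ e → - path (ρ i) e) (λ i′ → δ i i′ - δ zero i′) (∂z+r*z≡0 , -Σz≡0)
    where
      ∂z+r*z≡0 : ∀ v → ∂ Γ (λ e → - path (ρ i) e) v + push ρ (λ i′ → δ i i′ - δ zero i′) v ≡ 0ℤ
      ∂z+r*z≡0 v = begin
        ∂ Γ (λ e → - path (ρ i) e) v + push ρ (λ i′ → δ i i′ - δ zero i′) v
          ≡⟨ cong₂ _+_ (∂-neg (path (ρ i)) v) (push-- ρ (δ i) (δ zero) v) ⟩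
        - ∂ Γ (path (ρ i)) v + (push ρ (δ i) v - push ρ (δ zero) v)
          ≡⟨ cong₂ _+_ (cong -_ (∂-path (ρ i) v)) (cong₂ _-_ (push-δ ρ i v) (push-δ ρ zero v)) ⟩
        - (δ (ρ i) v - δ (ρ zero) v) + (δ (ρ i) v - δ (ρ zero) v)
          ≡⟨ +-inverseˡ (δ (ρ i) v - δ (ρ zero) v) ⟩
        0ℤ ∎
        where open ≡-Reasoning
      -Σz≡0 : - sumFin (suc m) (λ i′ → δ i i′ - δ zero i′) ≡ 0ℤ
      -Σz≡0 = cong -_ (trans (sumFin-distrib-- (suc m) (δ i) (δ zero))
                             (trans (cong₂ _-_ (sumFin-δ i) (sumFin-δ {suc m} zero)) (+-inverseʳ 1ℤ)))

  f-decomposition : ∀ (c : Cocycle) e′ →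
                    f c e′ ≡ f c · (λ e → fundamentalCycle e e′) + g c · (λ i → - path (ρ i) e′)
  f-decomposition c e′ = sym (begin
    f c · (λ e → δ e e′ - (F (t e) - F (o e))) + g c · (λ i → - F (ρ i))
      ≡⟨ cong₂ _+_ (·-distribˡ-- (f c) (λ e → δ e e′) _) (·-negʳ (g c) (F ∘ ρ)) ⟩
    f c · (λ e → δ e e′) - f c · (λ e → F (t e) - F (o e)) + - (g c · (F ∘ ρ))
      ≡⟨ cong (λ z → z + - (g c · (F ∘ ρ)))
              (cong₂ _-_ (trans (·-congʳ (f c) (λ e → δ-sym e e′)) (·-δ (f c) e′))
                         (sym (·-congʳ (f c) (∂*≡ F)))) ⟩
    f c e′ - f c · ∂* Γ F + - (g c · (F ∘ ρ))
      ≡⟨ regroup (f c e′) (f c · ∂* Γ F) (g c · (F ∘ ρ)) ⟩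
    f c e′ - (f c · ∂* Γ F + g c · (F ∘ ρ))
      ≡⟨ cong (λ z → f c e′ - z) (cocycle-orthogonal {f c} {g c} (closed c) F) ⟩
    f c e′ - 0ℤ
      ≡⟨ +-identityʳ (f c e′) ⟩
    f c e′ ∎)
    where
      open ≡-Reasoning
      F : Fin nV → ℤ
      F v = path v e′
      regroup : ∀ a x y → a - x + - y ≡ a - (x + y)
      regroup = solve-∀

  g-decomposition : ∀ (c : Cocycle) i′ → g c i′ ≡ f c · (λ _ → 0ℤ) + g c · (λ i → δ i i′ - δ zero i′)
  g-decomposition c i′ = sym (begin
    f c · (λ _ → 0ℤ) + g c · (λ i → δ i i′ - δ zero i′)
      ≡⟨ cong₂ _+_ (·-zeroʳ (f c)) (·-distribˡ-- (g c) (λ i → δ i i′) (λ _ → δ zero i′)) ⟩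
    0ℤ + (g c · (λ i → δ i i′) - g c · (λ _ → δ zero i′))
      ≡⟨ cong (_+_ 0ℤ) (cong₂ _-_ (trans (·-congʳ (g c) (λ i → δ-sym i i′)) (·-δ (g c) i′))
                                  (·-constʳ (g c) (δ zero i′))) ⟩
    0ℤ + (g c i′ - δ zero i′ * sumFin (suc m) (g c))
      ≡⟨ cong (λ z → 0ℤ + (g c i′ - δ zero i′ * z)) Σg≡0 ⟩
    0ℤ + (g c i′ - δ zero i′ * 0ℤ)
      ≡⟨ drop-zero (g c i′) (δ zero i′) ⟩
    g c i′ ∎)
    where
      open ≡-Reasoning
      Σg≡0 : sumFin (suc m) (g c) ≡ 0ℤ
      Σg≡0 = neg-injective {sumFin (suc m) (g c)} {0ℤ} (proj₂ (closed c))
      drop-zero : ∀ a d → 0ℤ + (a - d * 0ℤ) ≡ a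
      drop-zero = solve-∀

  module _ (φ : Dual Γ (suc m) ρ) where
    open Evaluation φ

    eval-decomposition : ∀ (c : Cocycle) → eval c ≡ f c · (eval ∘ edgeCycle) + g c · (eval ∘ legCycle)
    eval-decomposition c = begin
      eval c                                           ≡⟨ eval-cong c expansion f≡ g≡ ⟩
      eval expansion
        ≡⟨ eval-+ (lincomb (f c) edgeCycle) (lincomb (g c) legCycle) ⟩
      eval (lincomb (f c) edgeCycle) + eval (lincomb (g c) legCycle)
        ≡⟨ cong₂ _+_ (eval-lincomb (f c) edgeCycle) (eval-lincomb (g c) legCycle) ⟩
      f c · (eval ∘ edgeCycle) + g c · (eval ∘ legCycle) ∎
      where
        open ≡-Reasoning
        expansion : Cocycle
        expansion = lincomb (f c) edgeCycle +ᶜ lincomb (g c) legCycle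
        f≡ : f c ≗ f expansion
        f≡ e′ = trans (f-decomposition c e′)
                      (sym (cong₂ _+_ (f-lincomb (f c) edgeCycle e′) (f-lincomb (g c) legCycle e′)))
        g≡ : g c ≗ g expansion
        g≡ i′ = trans (g-decomposition c i′)
                      (sym (cong₂ _+_ (g-lincomb (f c) edgeCycle i′) (g-lincomb (g c) legCycle i′)))

    fun~ajFun : _~J_ Γ (suc m) ρ (Dual.fun φ) (ajFun Γ (suc m) ρ (eval ∘ edgeCycle) (eval ∘ legCycle))
    fun~ajFun = (λ _ → 0ℤ) , ∂-zero , agrees
      where
        open ≡-Reasoning
        γ = eval ∘ edgeCycle
        c = eval ∘ legCycle
        agrees : ∀ f′ g′ p → Dual.fun φ f′ g′ p ≡ f′ · γ + c · g′ + f′ · (λ _ → 0ℤ)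
        agrees f′ g′ p = begin
          eval (cocycle f′ g′ p)   ≡⟨ eval-decomposition (cocycle f′ g′ p) ⟩
          f′ · γ + g′ · c          ≡⟨ cong (_+_ (f′ · γ)) (·-comm g′ c) ⟩
          f′ · γ + c · g′          ≡⟨ sym (+-identityʳ _) ⟩
          f′ · γ + c · g′ + 0ℤ     ≡⟨ cong (_+_ (f′ · γ + c · g′)) (sym (·-zeroʳ f′)) ⟩
          f′ · γ + c · g′ + f′ · (λ _ → 0ℤ) ∎

  AJ-surjective : (φ : Dual Γ (suc m) ρ) →
                  ∃ λ (D : Fin nV → ℤ) → ∃ λ (c : Fin (suc m) → ℤ) → ∃ λ (γ : Fin nE → ℤ) →
                    deg Γ D ≡ 0ℤ × (∀ v → ∂ Γ γ v ≡ D v) ×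
                    _~J_ Γ (suc m) ρ (Dual.fun φ) (ajFun Γ (suc m) ρ γ c)
  AJ-surjective φ = ∂ Γ γ , Evaluation.eval φ ∘ legCycle , γ , deg-∂ γ , (λ _ → refl) , fun~ajFun φ
    where γ = Evaluation.eval φ ∘ edgeCycle

  potential : (Fin nE → ℤ) → (Fin (suc m) → ℤ) → Fin nV → ℤ
  potential y c v = c zero + y · path v

  annihilator⇒coboundary : ∀ y c → (∀ f′ g′ → IsCocycle Γ (suc m) ρ f′ g′ → f′ · y + c · g′ ≡ 0ℤ) →
                           (∀ e → y e ≡ ∂* Γ (potential y c) e) × (∀ i → c i ≡ potential y c (ρ i))
  annihilator⇒coboundary y c annihilates = y≡∂*x , c≡x∘ρ
    where
      open ≡-Reasoning
      P : Fin nV → ℤ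
      P v = y · path v
      y≡∂*x : ∀ e → y e ≡ ∂* Γ (potential y c) e
      y≡∂*x e = trans (x∙y⁻¹≈ε⇒x≈y _ _ (begin
        y e - ((c zero + P (t e)) - (c zero + P (o e)))   ≡⟨ rearrange (y e) (P (t e)) (P (o e)) (c zero) ⟩
        y e - (P (t e) - P (o e)) + 0ℤ
          ≡⟨ sym (cong₂ _+_ (trans (·-comm (fundamentalCycle e) y)
                                   (trans (·-distribˡ-- y (δ e) _)
                                          (cong₂ _-_ (·-δ y e) (·-distribˡ-- y _ _))))
                            (·-zeroʳ c)) ⟩
        fundamentalCycle e · y + c · (λ _ → 0ℤ)
          ≡⟨ annihilates (f (edgeCycle e)) (g (edgeCycle e)) (closed (edgeCycle e)) ⟩
        0ℤ                                                ∎))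
        (sym (∂*≡ (potential y c) e))
        where rearrange : ∀ a p q c₀ → a - ((c₀ + p) - (c₀ + q)) ≡ a - (p - q) + 0ℤ
              rearrange = solve-∀
      c≡x∘ρ : ∀ i → c i ≡ potential y c (ρ i)
      c≡x∘ρ i = x∙y⁻¹≈ε⇒x≈y _ _ (begin
        c i - (c zero + P (ρ i))                           ≡⟨ rearrange (c i) (c zero) (P (ρ i)) ⟩
        - P (ρ i) + (c i - c zero)
          ≡⟨ sym (cong₂ _+_ (trans (·-comm _ y) (·-negʳ y (path (ρ i))))
                            (trans (·-distribˡ-- c (δ i) (δ zero)) (cong₂ _-_ (·-δ c i) (·-δ c zero)))) ⟩
        (λ e → - path (ρ i) e) · y + c · (λ i′ → δ i i′ - δ zero i′)
          ≡⟨ annihilates (f (legCycle i)) (g (legCycle i)) (closed (legCycle i)) ⟩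
        0ℤ                                                 ∎)
        where rearrange : ∀ a c₀ p → a - (c₀ + p) ≡ - p + (a - c₀)
              rearrange = solve-∀

  ker-AJ⊆Prin : ∀ D c γ → (∀ v → ∂ Γ γ v ≡ D v) →
                _~J_ Γ (suc m) ρ (ajFun Γ (suc m) ρ γ c) (zeroJ Γ (suc m) ρ) → InPrin Γ (suc m) ρ D c
  ker-AJ⊆Prin D c γ ∂γ≡D (δ′ , ∂δ′≡0 , AJ≡⟪δ′⟫) = x , D≡Δ₀x , λ i → trans (c≡x∘ρ i) (sym (·-δ x (ρ i)))
    where
      open ≡-Reasoning
      y : Fin nE → ℤ
      y e = γ e - δ′ e
      annihilates : ∀ f′ g′ → IsCocycle Γ (suc m) ρ f′ g′ → f′ · y + c · g′ ≡ 0ℤ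
      annihilates f′ g′ p = begin
        f′ · y + c · g′                       ≡⟨ cong (λ z → z + c · g′) (·-distribˡ-- f′ γ δ′) ⟩
        f′ · γ - f′ · δ′ + c · g′             ≡⟨ rearrange (f′ · γ) (f′ · δ′) (c · g′) ⟩
        (f′ · γ + c · g′) - (0ℤ + f′ · δ′)    ≡⟨ x≈y⇒x∙y⁻¹≈ε (AJ≡⟪δ′⟫ f′ g′ p) ⟩
        0ℤ                                    ∎
        where rearrange : ∀ a b d → a - b + d ≡ (a + d) - (0ℤ + b)
              rearrange = solve-∀
      x : Fin nV → ℤ
      x = potential y c
      y≡∂*x = proj₁ (annihilator⇒coboundary y c annihilates)
      c≡x∘ρ = proj₂ (annihilator⇒coboundary y c annihilates)
      D≡Δ₀x : ∀ v → D v ≡ Δ₀ Γ x v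
      D≡Δ₀x v = sym (begin
        ∂ Γ (∂* Γ x) v        ≡⟨ ∂-cong (λ e → sym (y≡∂*x e)) v ⟩
        ∂ Γ y v               ≡⟨ ∂-- γ δ′ v ⟩
        ∂ Γ γ v - ∂ Γ δ′ v    ≡⟨ cong₂ _-_ (∂γ≡D v) (∂δ′≡0 v) ⟩
        D v - 0ℤ              ≡⟨ +-identityʳ (D v) ⟩
        D v                   ∎)

  Prin⊆ker-AJ : ∀ D c γ → (∀ v → ∂ Γ γ v ≡ D v) →
                InPrin Γ (suc m) ρ D c → _~J_ Γ (suc m) ρ (ajFun Γ (suc m) ρ γ c) (zeroJ Γ (suc m) ρ)
  Prin⊆ker-AJ D c γ ∂γ≡D (x , D≡Δ₀x , c≡x·δ) = δ′ , ∂δ′≡0 , agrees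
    where
      open ≡-Reasoning
      δ′ : Fin nE → ℤ
      δ′ e = γ e - ∂* Γ x e
      ∂δ′≡0 : ∀ v → ∂ Γ δ′ v ≡ 0ℤ
      ∂δ′≡0 v = trans (∂-- γ (∂* Γ x) v)
                      (trans (cong (λ z → z - Δ₀ Γ x v) (trans (∂γ≡D v) (D≡Δ₀x v))) (+-inverseʳ (Δ₀ Γ x v)))
      agrees : ∀ f′ g′ → IsCocycle Γ (suc m) ρ f′ g′ → f′ · γ + c · g′ ≡ 0ℤ + f′ · δ′
      agrees f′ g′ p = begin
        f′ · γ + c · g′
          ≡⟨ cong (_+_ (f′ · γ)) (trans (·-comm c g′) (·-congʳ g′ (λ i → trans (c≡x·δ i) (·-δ x (ρ i))))) ⟩
        f′ · γ + g′ · (x ∘ ρ)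
          ≡⟨ rearrange (f′ · γ) (f′ · ∂* Γ x) (g′ · (x ∘ ρ)) ⟩
        0ℤ + (f′ · γ - f′ · ∂* Γ x) + (f′ · ∂* Γ x + g′ · (x ∘ ρ))
          ≡⟨ cong (_+_ (0ℤ + (f′ · γ - f′ · ∂* Γ x))) (cocycle-orthogonal {f′} {g′} p x) ⟩
        0ℤ + (f′ · γ - f′ · ∂* Γ x) + 0ℤ                    ≡⟨ +-identityʳ _ ⟩
        0ℤ + (f′ · γ - f′ · ∂* Γ x)
          ≡⟨ cong (_+_ 0ℤ) (sym (·-distribˡ-- f′ γ (∂* Γ x))) ⟩
        0ℤ + f′ · δ′                                         ∎
        where rearrange : ∀ a b d → a + d ≡ 0ℤ + (a - b) + (b + d)
              rearrange = solve-∀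

theorem3p3p4 :
    (Γ : Graph) → (k : ℕ) → Graph.nV Γ ≡ suc k → Connected Γ →
    (m : ℕ) (ρ : Fin (suc m) → V Γ) →
    ((D : V Γ → ℤ) → deg Γ D ≡ 0ℤ → ∃ λ γ → ∀ v → ∂ Γ γ v ≡ D v)
    × ((φ : Dual Γ (suc m) ρ) →
        ∃ λ (D : V Γ → ℤ) → ∃ λ (c : Fin (suc m) → ℤ) → ∃ λ (γ : E Γ → ℤ) →
          deg Γ D ≡ 0ℤ × (∀ v → ∂ Γ γ v ≡ D v) ×
          _~J_ Γ (suc m) ρ (Dual.fun φ) (ajFun Γ (suc m) ρ γ c))
    × ((D : V Γ → ℤ) (c : Fin (suc m) → ℤ) (γ : E Γ → ℤ) →
        deg Γ D ≡ 0ℤ → (∀ v → ∂ Γ γ v ≡ D v) →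
        (_~J_ Γ (suc m) ρ (ajFun Γ (suc m) ρ γ c) (zeroJ Γ (suc m) ρ)
          ⇔ InPrin Γ (suc m) ρ D c))
-- The vertex ρ zero already witnesses that V is nonempty.
theorem3p3p4 Γ _ _ connected m ρ =
  deg≡0⇒boundary , AJ-surjective ,
  λ D c γ _ ∂γ≡D → mk⇔ (ker-AJ⊆Prin D c γ ∂γ≡D) (Prin⊆ker-AJ D c γ ∂γ≡D)
  where
    open Paths Γ connected (ρ zero)
    open AbelJacobi Γ connected ρ
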